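{- If $\overrightarrow{G}$ is a difference distance magic oriented graph (DDMOG) of order $n$ with $imb(\overrightarrow{G})=1$, then there exists a DDMOG $\overrightarrow{G'}$ of order $n+1$ with $imb(\overrightarrow{G'})=0$ that contains $\overrightarrow{G}$ as an induced subgraph.
   Context: An oriented graph is a digraph with no loops, no multiple arcs, and such that $(u,v)$ being an arc implies $(v,u)$ is not an arc. $N^+(v)$ is the set of $u$ with $(u,v)$ an arc, $N^-(v)$ the set of $u$ with $(v,u)$ an arc. The imbalance of a vertex is $imb(v)=|N^+(v)|-|N^-(v)|$ and the imbalance of a digraph $D$ is $imb(D)=\max_{v\in V(D)}|imb(v)|$. For a labeling $f$, $wt_f(v)=\sum_{u\in N^+(v)} f(u) - \sum_{u \in N^-(v)} f(u)$. A difference distance magic labeling of an oriented graph on $n$ vertices is a bijection $f: V\to\{1,\dots,n\}$ with $wt_f(v)=0$ for all $v$; an oriented graph admitting one is a DDMOG. -}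

module Defs where

open import Data.Nat using (ℕ; suc; _⊔_)
open import Data.Bool using (Bool; true; false; if_then_else_)
open import Data.Fin using (Fin; toℕ)
open import Data.List using (List; map; foldr; allFin; filter)
open import Data.Integer using (ℤ; +_; _-_; _+_; ∣_∣)
open import Data.Product using (Σ; _×_; ∃)
open import Relation.Binary.PropositionalEquality using (_≡_)
open import Relation.Nullary using (¬_)
open import Function.Definitions using (Bijective; Injective)

record OrientedGraph (n : ℕ) : Set where
  field
    arc        : Fin n → Fin n → Bool
    loopless   : ∀ v → arc v v ≡ false
    antisym    : ∀ u v → arc u v ≡ true → arc v u ≡ false

open OrientedGraph public

Σv : {n : ℕ} → (Fin n → ℤ) → ℤ
Σv {n} g = foldr _+_ (+ 0) (map g (allFin n))

[_] : Bool → ℤ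
[ true ]  = + 1
[ false ] = + 0

-- |N⁺(v)| : u with (u,v) an arc ;  |N⁻(v)| : u with (v,u) an arc
indeg : {n : ℕ} → OrientedGraph n → Fin n → ℤ
indeg G v = Σv (λ u → [ arc G u v ])

outdeg : {n : ℕ} → OrientedGraph n → Fin n → ℤ
outdeg G v = Σv (λ u → [ arc G v u ])

imb : {n : ℕ} → OrientedGraph n → Fin n → ℤ
imb G v = indeg G v - outdeg G v

imbD : {n : ℕ} → OrientedGraph n → ℕ
imbD {n} G = foldr _⊔_ 0 (map (λ v → ∣ imb G v ∣) (allFin n))

wt : {n : ℕ} → OrientedGraph n → (Fin n → ℕ) → Fin n → ℤ
wt G f v = Σv (λ u → (if arc G u v then + f u else + 0))
         - Σv (λ u → (if arc G v u then + f u else + 0))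

-- label function induced by a permutation σ of Fin n: v ↦ σ(v)+1 ∈ {1,…,n}
label : {n : ℕ} → (Fin n → Fin n) → Fin n → ℕ
label σ v = suc (toℕ (σ v))

IsDDML : {n : ℕ} → OrientedGraph n → (Fin n → Fin n) → Set
IsDDML G σ = Bijective _≡_ _≡_ σ × (∀ v → wt G (label σ) v ≡ + 0)

IsDDMOG : {n : ℕ} → OrientedGraph n → Set
IsDDMOG {n} G = Σ (Fin n → Fin n) (IsDDML G)

InducedSubgraph : {n m : ℕ} → OrientedGraph n → OrientedGraph m → Set
InducedSubgraph {n} {m} G H =
  Σ (Fin n → Fin m) λ ι → Injective _≡_ _≡_ ι × (∀ u v → arc H (ι u) (ι v) ≡ arc G u v)

{-# OPTIONS --safe #-}
-- Add a vertex 0 with label 1, shift every old label up by one, and join 0 to each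
-- vertex of imbalance ±1 by the arc that cancels that imbalance.  At an old vertex the
-- shift adds its imbalance to the weight, and the new arc (from a vertex labelled 1)
-- subtracts it again.  The new vertex is handled globally: in every oriented graph the
-- imbalances sum to 0, and ∑ wt(v) + ∑ imb(v) f(v) is the total net flow of the arc
-- weights f(u) + f(w), hence 0; so once every other vertex is balanced with weight 0,
-- so is vertex 0.
module Submission where

open import Defs
open import Data.Nat as ℕ using (ℕ; suc; _≤_; s≤s; _⊔_)
open import Data.Nat.Properties using (≤-refl; m⊔n≤o⇒m≤o; m⊔n≤o⇒n≤o)
open import Data.Bool using (Bool; true; false; if_then_else_)
open import Data.Fin using (Fin; zero; suc; lift)
open import Data.Fin.Properties using (suc-injective; lift-injective)
open import Data.List using (map; foldr; tabulate; allFin)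
open import Data.List.Properties using (map-tabulate; foldr-forcesᵇ; foldr-preservesᵇ)
open import Data.List.Relation.Unary.All as All using (All)
open import Data.List.Relation.Unary.All.Properties using (map⁺; map⁻)
open import Data.List.Membership.Propositional.Properties using (∈-allFin)
open import Data.Integer using (ℤ; +_; -[1+_]; -1ℤ; _-_; _+_; _*_; -_; ∣_∣)
open import Data.Integer.Properties
  using (+-*-semiring; +-inverseʳ; +-identityˡ; +-identityʳ; *-identityˡ; *-identityʳ; *-zeroˡ; -1*i≡-i)
open import Data.Integer.Tactic.RingSolver using (solve-∀)
open import Algebra.Properties.Semiring.Sum +-*-semiring
  using (sum; sum-cong-≗; sum-replicate-zero; ∑-distrib-+; ∑-comm; *-distribˡ-sum; *-distribʳ-sum)
open import Data.Product using (Σ; _×_; _,_)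
open import Function using (id; _∘_; flip)
open import Function.Definitions using (Bijective)
open import Relation.Binary.PropositionalEquality hiding ([_])
open ≡-Reasoning

Σv≡sum : ∀ {n} (g : Fin n → ℤ) → Σv g ≡ sum g
Σv≡sum {ℕ.zero} g = refl
Σv≡sum {suc n}  g = cong (_+_ (g zero)) (begin
  foldr _+_ (+ 0) (map g (tabulate suc)) ≡⟨ cong (foldr _+_ (+ 0)) (map-tabulate suc g) ⟩
  foldr _+_ (+ 0) (tabulate (g ∘ suc))  ≡⟨ cong (foldr _+_ (+ 0)) (map-tabulate id (g ∘ suc)) ⟨
  Σv (g ∘ suc)                         ≡⟨ Σv≡sum (g ∘ suc) ⟩
  sum (g ∘ suc)                        ∎)

Σv-suc : ∀ {n} (g : Fin (suc n) → ℤ) → Σv g ≡ g zero + Σv (g ∘ suc)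
Σv-suc g = trans (Σv≡sum g) (cong (_+_ (g zero)) (sym (Σv≡sum (g ∘ suc))))

Σv-cong : ∀ {n} {g h : Fin n → ℤ} → (∀ i → g i ≡ h i) → Σv g ≡ Σv h
Σv-cong {g = g} {h} g≗h = trans (Σv≡sum g) (trans (sum-cong-≗ g≗h) (sym (Σv≡sum h)))

Σv-distrib-+ : ∀ {n} (g h : Fin n → ℤ) → Σv (λ i → g i + h i) ≡ Σv g + Σv h
Σv-distrib-+ g h = begin
  Σv (λ i → g i + h i)  ≡⟨ Σv≡sum (λ i → g i + h i) ⟩
  sum (λ i → g i + h i) ≡⟨ ∑-distrib-+ g h ⟩
  sum g + sum h         ≡⟨ cong₂ _+_ (Σv≡sum g) (Σv≡sum h) ⟨
  Σv g + Σv h           ∎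

Σv≡0∧tail≡0⇒≡0 : ∀ {n} {g : Fin (suc n) → ℤ} →
  Σv g ≡ + 0 → (∀ i → g (suc i) ≡ + 0) → ∀ i → g i ≡ + 0
Σv≡0∧tail≡0⇒≡0 {n} {g} Σg≡0 tail≡0 zero = begin
  g zero                        ≡⟨ +-identityʳ (g zero) ⟨
  g zero + + 0                  ≡⟨ cong (_+_ (g zero)) (sum-replicate-zero n) ⟨
  g zero + sum {n} (λ _ → + 0)  ≡⟨ cong (_+_ (g zero)) (trans (Σv≡sum (g ∘ suc)) (sum-cong-≗ tail≡0)) ⟨
  g zero + Σv (g ∘ suc)         ≡⟨ Σv-suc g ⟨
  Σv g                          ≡⟨ Σg≡0 ⟩
  + 0                           ∎
Σv≡0∧tail≡0⇒≡0 Σg≡0 tail≡0 (suc i) = tail≡0 i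

sum-neg : ∀ {n} (g : Fin n → ℤ) → sum (λ i → - g i) ≡ - sum g
sum-neg g = begin
  sum (λ i → - g i)      ≡⟨ sum-cong-≗ (λ i → -1*i≡-i (g i)) ⟨
  sum (λ i → -1ℤ * g i)  ≡⟨ *-distribˡ-sum -1ℤ g ⟨
  -1ℤ * sum g            ≡⟨ -1*i≡-i (sum g) ⟩
  - sum g                ∎

sum-distrib-- : ∀ {n} (g h : Fin n → ℤ) → sum (λ i → g i - h i) ≡ sum g - sum h
sum-distrib-- g h = trans (∑-distrib-+ g (λ i → - h i)) (cong (_+_ (sum g)) (sum-neg h))

netFlow : ∀ {n} → (Fin n → Fin n → ℤ) → Fin n → ℤ
netFlow M v = sum (λ u → M u v) - sum (λ u → M v u)

sum-netFlow : ∀ {n} (M : Fin n → Fin n → ℤ) → sum (netFlow M) ≡ + 0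
sum-netFlow {n} M = begin
  sum (netFlow M)           ≡⟨ sum-distrib-- (λ v → sum (λ u → M u v)) (λ v → sum (λ u → M v u)) ⟩
  total (flip M) - total M  ≡⟨ cong (_- total M) (∑-comm {n} {n} (flip M)) ⟩
  total M - total M         ≡⟨ +-inverseʳ (total M) ⟩
  + 0                       ∎
  where
  total : (Fin n → Fin n → ℤ) → ℤ
  total N = sum (λ v → sum (N v))

ite≡[]* : ∀ b x → (if b then x else + 0) ≡ [ b ] * x
ite≡[]* true  x = sym (*-identityˡ x)
ite≡[]* false x = sym (*-zeroˡ x)

ite-suc : ∀ b x → (if b then + suc x else + 0) ≡ [ b ] + (if b then + x else + 0)
ite-suc true  x = refl
ite-suc false x = refl

module _ {n : ℕ} (G : OrientedGraph n) where

  private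
    a : Fin n → Fin n → ℤ
    a u w = [ arc G u w ]

    inLabels outLabels : (Fin n → ℕ) → Fin n → Fin n → ℤ
    inLabels  f v u = if arc G u v then + f u else + 0
    outLabels f v u = if arc G v u then + f u else + 0

    pairFlow : (Fin n → ℕ) → Fin n → Fin n → ℤ
    pairFlow f u w = a u w * + f u + a u w * + f w

  imb≡netFlow : ∀ v → imb G v ≡ netFlow a v
  imb≡netFlow v = cong₂ _-_ (Σv≡sum (λ u → a u v)) (Σv≡sum (a v))

  Σv-imb : Σv (imb G) ≡ + 0
  Σv-imb = trans (Σv≡sum (imb G)) (trans (sum-cong-≗ imb≡netFlow) (sum-netFlow a))

  wt≡sum : ∀ f v → wt G f v ≡ sum (λ u → a u v * + f u) - sum (λ u → a v u * + f u)
  wt≡sum f v = cong₂ _-_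
    (trans (Σv≡sum (inLabels f v))  (sum-cong-≗ (λ u → ite≡[]* (arc G u v) (+ f u))))
    (trans (Σv≡sum (outLabels f v)) (sum-cong-≗ (λ u → ite≡[]* (arc G v u) (+ f u))))

  wt+imb*f≡netFlow : ∀ f v → wt G f v + imb G v * + f v ≡ netFlow (pairFlow f) v
  wt+imb*f≡netFlow f v = begin
    wt G f v + imb G v * F v
      ≡⟨ cong₂ (λ x y → x + y * F v) (wt≡sum f v) (imb≡netFlow v) ⟩
    (inF - outF) + (sum (λ u → a u v) - sum (a v)) * F v
      ≡⟨ rearrange inF outF (sum (λ u → a u v)) (sum (a v)) (F v) ⟩
    (inF + sum (λ u → a u v) * F v) - (sum (a v) * F v + outF)
      ≡⟨ cong₂ (λ x y → (inF + x) - (y + outF)) (*-distribʳ-sum (F v) (λ u → a u v)) (*-distribʳ-sum (F v) (a v)) ⟩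
    (inF + sum (λ u → a u v * F v)) - (sum (λ u → a v u * F v) + outF)
      ≡⟨ cong₂ _-_ (∑-distrib-+ (λ u → a u v * F u) (λ u → a u v * F v))
                   (∑-distrib-+ (λ u → a v u * F v) (λ u → a v u * F u)) ⟨
    netFlow (pairFlow f) v
      ∎
    where
    F : Fin n → ℤ
    F u = + f u
    inF outF : ℤ
    inF  = sum (λ u → a u v * F u)
    outF = sum (λ u → a v u * F u)
    rearrange : ∀ p q r s x → (p - q) + (r - s) * x ≡ (p + r * x) - (s * x + q)
    rearrange = solve-∀

  Σv-wt-balanced : (∀ v → imb G v ≡ + 0) → ∀ f → Σv (wt G f) ≡ + 0
  Σv-wt-balanced balanced f = begin
    Σv (wt G f)                             ≡⟨ Σv≡sum (wt G f) ⟩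
    sum (wt G f)                            ≡⟨ sum-cong-≗ wt≡wt+imb*f ⟩
    sum (λ v → wt G f v + imb G v * + f v)  ≡⟨ sum-cong-≗ (wt+imb*f≡netFlow f) ⟩
    sum (netFlow (pairFlow f))              ≡⟨ sum-netFlow (pairFlow f) ⟩
    + 0                                     ∎
    where
    wt≡wt+imb*f : ∀ v → wt G f v ≡ wt G f v + imb G v * + f v
    wt≡wt+imb*f v = begin
      wt G f v                    ≡⟨ +-identityʳ (wt G f v) ⟨
      wt G f v + + 0              ≡⟨ cong (_+_ (wt G f v)) (*-zeroˡ (+ f v)) ⟨
      wt G f v + + 0 * + f v      ≡⟨ cong (λ i → wt G f v + i * + f v) (balanced v) ⟨
      wt G f v + imb G v * + f v  ∎

  wt-suc∘ : ∀ f v → wt G (ℕ.suc ∘ f) v ≡ wt G f v + imb G v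
  wt-suc∘ f v = begin
    wt G (ℕ.suc ∘ f) v
      ≡⟨ cong₂ _-_ (trans (Σv-cong (λ u → ite-suc (arc G u v) (f u))) (Σv-distrib-+ (λ u → a u v) (inLabels f v)))
                   (trans (Σv-cong (λ u → ite-suc (arc G v u) (f u))) (Σv-distrib-+ (a v) (outLabels f v))) ⟩
    (indeg G v + Σv (inLabels f v)) - (outdeg G v + Σv (outLabels f v))
      ≡⟨ rearrange (indeg G v) (Σv (inLabels f v)) (outdeg G v) (Σv (outLabels f v)) ⟩
    wt G f v + imb G v
      ∎
    where
    rearrange : ∀ r p s q → (r + p) - (s + q) ≡ (p - q) + (r - s)
    rearrange = solve-∀

lift₁-bijective : ∀ {n} {σ : Fin n → Fin n} → Bijective _≡_ _≡_ σ → Bijective _≡_ _≡_ (lift 1 σ)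
lift₁-bijective {σ = σ} (σ-injective , σ-surjective) = lift-injective σ σ-injective 1 , surjective
  where
  surjective : ∀ y → Σ _ λ x → ∀ {z} → z ≡ x → lift 1 σ z ≡ y
  surjective zero    = zero , λ { refl → refl }
  surjective (suc y) with σ-surjective y
  ... | x , σx≡y = suc x , λ { refl → cong suc (σx≡y refl) }

isPos isNeg : ℤ → Bool
isPos (+ ℕ.zero)  = false
isPos (+ suc _)   = true
isPos -[1+ _ ]    = false
isNeg (+ _)       = false
isNeg -[1+ _ ]    = true

isPos⇒¬isNeg : ∀ z → isPos z ≡ true → isNeg z ≡ false
isPos⇒¬isNeg (+ suc _) _ = refl

isNeg⇒¬isPos : ∀ z → isNeg z ≡ true → isPos z ≡ false
isNeg⇒¬isPos -[1+ _ ] _ = refl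

signum : ℤ → ℤ
signum z = [ isPos z ] - [ isNeg z ]

∣z∣≤1⇒signum≡z : ∀ {z} → ∣ z ∣ ≤ 1 → signum z ≡ z
∣z∣≤1⇒signum≡z {+ ℕ.zero}     _ = refl
∣z∣≤1⇒signum≡z {+ suc ℕ.zero} _ = refl
∣z∣≤1⇒signum≡z { -[1+ ℕ.zero ] } _ = refl
∣z∣≤1⇒signum≡z {+ suc (suc _)} (s≤s ())
∣z∣≤1⇒signum≡z { -[1+ suc _ ] } (s≤s ())

addBalancingVertex : ∀ {n} → OrientedGraph n → OrientedGraph (suc n)
addBalancingVertex {n} G = record { arc = arc′ ; loopless = loopless′ ; antisym = antisym′ }
  where
  arc′ : Fin (suc n) → Fin (suc n) → Bool
  arc′ zero    zero    = false
  arc′ zero    (suc v) = isNeg (imb G v)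
  arc′ (suc u) zero    = isPos (imb G u)
  arc′ (suc u) (suc v) = arc G u v

  loopless′ : ∀ v → arc′ v v ≡ false
  loopless′ zero    = refl
  loopless′ (suc v) = loopless G v

  antisym′ : ∀ u v → arc′ u v ≡ true → arc′ v u ≡ false
  antisym′ zero    (suc v) = isNeg⇒¬isPos (imb G v)
  antisym′ (suc u) zero    = isPos⇒¬isNeg (imb G u)
  antisym′ (suc u) (suc v) = antisym G u v

module _ {n : ℕ} (G : OrientedGraph n) where

  private
    G′ : OrientedGraph (suc n)
    G′ = addBalancingVertex G

  addBalancingVertex-induced : InducedSubgraph G G′
  addBalancingVertex-induced = suc , suc-injective , λ _ _ → refl

  imb-addBalancingVertex-suc : ∀ v → imb G′ (suc v) ≡ imb G v - signum (imb G v)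
  imb-addBalancingVertex-suc v = begin
    imb G′ (suc v)
      ≡⟨ cong₂ _-_ (Σv-suc (λ u → [ arc G′ u (suc v) ])) (Σv-suc (λ u → [ arc G′ (suc v) u ])) ⟩
    ([ isNeg (imb G v) ] + indeg G v) - ([ isPos (imb G v) ] + outdeg G v)
      ≡⟨ rearrange [ isNeg (imb G v) ] (indeg G v) [ isPos (imb G v) ] (outdeg G v) ⟩
    imb G v - signum (imb G v)
      ∎
    where
    rearrange : ∀ x p y q → (x + p) - (y + q) ≡ (p - q) - (y - x)
    rearrange = solve-∀

  wt-addBalancingVertex-suc : ∀ (f : Fin (suc n) → ℕ) v →
    wt G′ f (suc v) ≡ wt G (f ∘ suc) v - signum (imb G v) * + f zero
  wt-addBalancingVertex-suc f v = begin
    wt G′ f (suc v)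
      ≡⟨ cong₂ _-_ (trans (Σv-suc inF′) (cong (_+ Σv (inF′ ∘ suc)) (ite≡[]* (isNeg (imb G v)) (+ f zero))))
                   (trans (Σv-suc outF′) (cong (_+ Σv (outF′ ∘ suc)) (ite≡[]* (isPos (imb G v)) (+ f zero)))) ⟩
    ([ isNeg (imb G v) ] * + f zero + Σv (inF′ ∘ suc)) - ([ isPos (imb G v) ] * + f zero + Σv (outF′ ∘ suc))
      ≡⟨ rearrange [ isNeg (imb G v) ] (Σv (inF′ ∘ suc)) [ isPos (imb G v) ] (Σv (outF′ ∘ suc)) (+ f zero) ⟩
    wt G (f ∘ suc) v - signum (imb G v) * + f zero
      ∎
    where
    inF′ outF′ : Fin (suc n) → ℤ
    inF′  u = if arc G′ u (suc v) then + f u else + 0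
    outF′ u = if arc G′ (suc v) u then + f u else + 0
    rearrange : ∀ x p y q c → (x * c + p) - (y * c + q) ≡ (p - q) - (y - x) * c
    rearrange = solve-∀

  imb-addBalancingVertex : (∀ v → ∣ imb G v ∣ ≤ 1) → ∀ v → imb G′ v ≡ + 0
  imb-addBalancingVertex bounded = Σv≡0∧tail≡0⇒≡0 (Σv-imb G′) imb-suc≡0
    where
    imb-suc≡0 : ∀ v → imb G′ (suc v) ≡ + 0
    imb-suc≡0 v = begin
      imb G′ (suc v)              ≡⟨ imb-addBalancingVertex-suc v ⟩
      imb G v - signum (imb G v)  ≡⟨ cong (_-_ (imb G v)) (∣z∣≤1⇒signum≡z (bounded v)) ⟩
      imb G v - imb G v           ≡⟨ +-inverseʳ (imb G v) ⟩
      + 0                         ∎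

  addBalancingVertex-DDML : (∀ v → ∣ imb G v ∣ ≤ 1) →
    ∀ {σ} → IsDDML G σ → IsDDML G′ (lift 1 σ)
  addBalancingVertex-DDML bounded {σ} (σ-bijective , wt≡0) =
    lift₁-bijective σ-bijective , Σv≡0∧tail≡0⇒≡0 (Σv-wt-balanced G′ (imb-addBalancingVertex bounded) f′) wt-suc≡0
    where
    f′ : Fin (suc n) → ℕ
    f′ = label (lift 1 σ)
    wt-suc≡0 : ∀ v → wt G′ f′ (suc v) ≡ + 0
    wt-suc≡0 v = begin
      wt G′ f′ (suc v)
        ≡⟨ wt-addBalancingVertex-suc f′ v ⟩
      wt G (ℕ.suc ∘ label σ) v - signum (imb G v) * + 1
        ≡⟨ cong₂ _-_ (wt-suc∘ G (label σ) v) (*-identityʳ (signum (imb G v))) ⟩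
      (wt G (label σ) v + imb G v) - signum (imb G v)
        ≡⟨ cong₂ (λ w s → (w + imb G v) - s) (wt≡0 v) (∣z∣≤1⇒signum≡z (bounded v)) ⟩
      (+ 0 + imb G v) - imb G v
        ≡⟨ cong (_- imb G v) (+-identityˡ (imb G v)) ⟩
      imb G v - imb G v
        ≡⟨ +-inverseʳ (imb G v) ⟩
      + 0
        ∎

∣imb∣≤imbD : ∀ {n} (G : OrientedGraph n) v → ∣ imb G v ∣ ≤ imbD G
∣imb∣≤imbD {n} G v = All.lookup (map⁻ all≤) (∈-allFin v)
  where
  all≤ : All (_≤ imbD G) (map (λ w → ∣ imb G w ∣) (allFin n))
  all≤ = foldr-forcesᵇ {P = _≤ imbD G} (λ x y x⊔y≤ → m⊔n≤o⇒m≤o x y x⊔y≤ , m⊔n≤o⇒n≤o x y x⊔y≤)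
           0 (map (λ w → ∣ imb G w ∣) (allFin n)) ≤-refl

imbD≡0 : ∀ {n} (G : OrientedGraph n) → (∀ v → imb G v ≡ + 0) → imbD G ≡ 0
imbD≡0 {n} G balanced = foldr-preservesᵇ {P = _≡ 0} {f = _⊔_} (λ { refl refl → refl }) refl
  (map⁺ (All.universal (λ v → cong ∣_∣ (balanced v)) (allFin n)))

theorem1 : (n : ℕ) (G : OrientedGraph n) → IsDDMOG G → imbD G ≡ 1 →
    Σ (OrientedGraph (suc n)) λ G' → IsDDMOG G' × imbD G' ≡ 0 × InducedSubgraph G G'
theorem1 n G (σ , σ-DDML) imbD≡1 =
  addBalancingVertex G ,
  (lift 1 σ , addBalancingVertex-DDML G bounded σ-DDML) ,
  imbD≡0 (addBalancingVertex G) (imb-addBalancingVertex G bounded) ,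
  addBalancingVertex-induced G
  where
  bounded : ∀ v → ∣ imb G v ∣ ≤ 1
  bounded v = subst (∣ imb G v ∣ ≤_) imbD≡1 (∣imb∣≤imbD G v)
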